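{- The class of lattice path delta-matroids is closed under duals and minors: if $D$ is a lattice path delta-matroid, then $D^*$ and every minor of $D$ are lattice path delta-matroids.
   Context: A set system is a pair $S=(E,\mathcal{F})$ with $E$ finite and $\mathcal{F}$ a collection of subsets of $E$; it is proper if $\mathcal{F}\neq\emptyset$. Isomorphism of set systems means a bijection of ground sets carrying feasible sets exactly onto feasible sets. For proper $S$ and $e\in E$: $e$ is a loop if no feasible set contains $e$, a coloop if every feasible set contains $e$. If $e$ is not a loop, $S/e=(E-e,\{F-e:e\in F\in\mathcal{F}\})$; if $e$ is not a coloop, $S\backslash e=(E-e,\{F\in\mathcal{F}:e\notin F\})$; if $e$ is a loop or coloop, $S/e$ and $S\backslash e$ are both set equal to whichever was defined. A minor is any set system obtained by a (possibly empty) sequence of such operations. The dual is $S^*=(E,\{E-F:F\in\mathcal{F}\})$. Lattice path data: fix integers $u,v,c,d\ge 0$ with $v-c\ge d$ and points $s_P=(0,0)$, $s_Q=(-d,d)$, $t_Q=(u,v)$, $t_P=(u+c,v-c)$. A lattice path is a sequence of unit north or east steps. Let $P$ be a lattice path from $s_P$ to $t_P$ and $Q$ one from $s_Q$ to $t_Q$ such that $P$ never crosses $Q$ ($P$ stays weakly south-east of $Q$). Let $\mathcal{R}$ be the region bounded by $P$, $Q$, the segment $s_Ps_Q$ and the segment $t_Pt_Q$. Let $s_i=(-i,i)$ ($0\le i\le d$), $t_j=(u+c-j,v-c+j)$ ($0\le j\le c$). Label each north step from $(x,y-1)$ to $(x,y)$ in $\mathcal{R}$ by $x+y$, and let $E=\{1,\ldots,u+v\}$.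 Let $\mathcal{P}$ be the set of lattice paths from some $s_i$ to some $t_j$ remaining in $\mathcal{R}$, and $b(P')$ the set of labels of north steps of $P'\in\mathcal{P}$. Then $(E,\{b(P'):P'\in\mathcal{P}\})$ is a delta-matroid; a lattice path delta-matroid is any set system isomorphic to one obtained in this way from some such data. -}

module Defs where

open import Data.Nat using (ℕ; zero; suc; _+_; _∸_; _≤_)
open import Data.Fin using (Fin)
open import Data.Fin.Subset using (Subset; inside; outside; _∈_; _∉_; ∁; ∣_∣)
open import Data.Vec using (Vec; []; _∷_; insertAt; tabulate; lookup)
open import Data.Product using (Σ; Σ-syntax; _×_)
open import Function.Bundles using (_↔_; _⇔_; Inverse)
open import Relation.Nullary using (¬_)
open import Relation.Binary.PropositionalEquality using (_≡_)

SetFamily : ℕ → Set₁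
SetFamily n = Subset n → Set

record SetSystem : Set₁ where
  constructor mkSS
  field
    size     : ℕ
    Feasible : SetFamily size
open SetSystem public

image : ∀ {n m} → (Fin n ↔ Fin m) → Subset n → Subset m
image σ F = tabulate (λ y → lookup F (Inverse.from σ y))

_≅_ : SetSystem → SetSystem → Set
S ≅ T = Σ[ σ ∈ (Fin (size S) ↔ Fin (size T)) ]
          (∀ F → Feasible S F ⇔ Feasible T (image σ F))

Proper : SetSystem → Set
Proper S = Σ[ F ∈ Subset (size S) ] Feasible S F

Loop : ∀ {n} → SetFamily n → Fin n → Set
Loop 𝓕 e = ∀ F → 𝓕 F → e ∉ F

Coloop : ∀ {n} → SetFamily n → Fin n → Set
Coloop 𝓕 e = ∀ F → 𝓕 F → e ∈ F

-- Ground set E - e is identified with Fin n via the insertion position e.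
-- Deletion  S\e : feasible sets of S avoiding e.
delete : ∀ {n} → SetFamily (suc n) → Fin (suc n) → SetFamily n
delete 𝓕 e F = 𝓕 (insertAt F e outside)

contract : ∀ {n} → SetFamily (suc n) → Fin (suc n) → SetFamily n
contract 𝓕 e F = 𝓕 (insertAt F e inside)

-- S\e is allowed when e is not a
-- coloop, S/e when e is not a loop (when e is a loop, S/e := S\e, and
-- when e is a coloop, S\e := S/e, so these are all the one-step minors).
data _≼_ : SetSystem → SetSystem → Set₁ where
  here : ∀ {S} → S ≼ S
  del  : ∀ {T n} {𝓕 : SetFamily (suc n)} (e : Fin (suc n)) →
         Proper (mkSS (suc n) 𝓕) → ¬ Coloop 𝓕 e →
         T ≼ mkSS n (delete 𝓕 e) → T ≼ mkSS (suc n) 𝓕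
  con  : ∀ {T n} {𝓕 : SetFamily (suc n)} (e : Fin (suc n)) →
         Proper (mkSS (suc n) 𝓕) → ¬ Loop 𝓕 e →
         T ≼ mkSS n (contract 𝓕 e) → T ≼ mkSS (suc n) 𝓕

dual : SetSystem → SetSystem
dual S = mkSS (size S) (λ F → Feasible S (∁ F))

-- A lattice path with n steps is encoded as a Subset n:
-- step k (0-based index k, i.e. label k+1) is north iff it is inside.
-- The point after k steps of a path lies on the antidiagonal x+y = k;
-- we record only its y-coordinate (x = k - y).

north# : ∀ {n} → Subset n → ℕ → ℕ
north# []           _       = 0
north# (_ ∷ _)      zero    = 0
north# (inside ∷ s)  (suc k) = suc (north# s k)
north# (outside ∷ s) (suc k) = north# s k

record LPData : Set where
  field
    u v c d : ℕ
    cd≤v    : c + d ≤ v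
    -- P : from s_P = (0,0) to t_P = (u+c, v-c)
    P       : Subset (u + v)
    P-ends  : ∣ P ∣ ≡ (v ∸ c)
    -- Q : from s_Q = (-d,d) to t_Q = (u,v)
    Q       : Subset (u + v)
    Q-ends  : ∣ Q ∣ ≡ (v ∸ d)
    -- P stays weakly south-east of Q: on each antidiagonal x+y = k,
    -- y-coordinate of P ≤ y-coordinate of Q
    noncross : ∀ k → k ≤ u + v → north# P k ≤ d + north# Q k

-- The family {b(P') : P' ∈ 𝓟}: B is feasible iff B is the north-step
-- label set of a lattice path from some s_i = (-i,i), 0 ≤ i ≤ d, to some
-- t_j = (u+c-j, v-c+j), 0 ≤ j ≤ c, all of whose points lie in the region
-- 𝓡 (on each antidiagonal x+y = k, between P and Q).
LPFeasible : (D : LPData) → SetFamily (LPData.u D + LPData.v D)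
LPFeasible D B =
  Σ[ i ∈ ℕ ] (i ≤ d) ×
    ((∀ k → k ≤ u + v →
        (north# P k ≤ i + north# B k) × (i + north# B k ≤ d + north# Q k)) ×
     (Σ[ j ∈ ℕ ] (j ≤ c) × (i + ∣ B ∣ ≡ (v ∸ c) + j)))
  where open LPData D

LPSystem : LPData → SetSystem
LPSystem D = mkSS (LPData.u D + LPData.v D) (LPFeasible D)

IsLatticePathDM : SetSystem → Set
IsLatticePathDM S = Σ[ D ∈ LPData ] (S ≅ LPSystem D)

-- Record a path by its height profile k ↦ north# B k, the number of north steps among its first
-- k steps. A set B is feasible in the lattice path delta-matroid of D iff some vertical shift
-- i + north# B k of its profile (i is the index of the start s_i) lies between the profiles of P
-- and of d + Q on every antidiagonal; the end point is then automatically some t_j. Call such a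
-- family, for arbitrary integer bounds lo and hi, a corridor. Corridors are closed under the
-- operations at hand: complementing B turns the profile h into k - h, so the dual is the corridor
-- between k - hi and k - lo; deleting or contracting the element at position p fixes step p,
-- which merges the constraints on antidiagonals p and p + 1 into one. Conversely, a nonempty
-- corridor is a lattice path delta-matroid: replacing the bounds by their tightest envelopes with
-- steps 0 or 1 (capped so that the end points match up) changes no feasible set, and two such
-- envelopes are the profiles of two noncrossing lattice paths.

module Submission where

open import Defs
open import Data.Product using (_×_; Σ-syntax; _,_; proj₁; proj₂)
open import Data.Bool using (Bool; true; false; not)
open import Data.Bool.Properties using (not-involutive; ¬-not)
open import Data.Empty using (⊥-elim)
open import Data.Fin using (Fin; toℕ; punchIn; punchOut)
open import Data.Fin.Permutation using (remove; punchIn-permute; inverseˡ; inverseʳ)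
open import Data.Fin.Properties using (toℕ≤pred[n]; punchIn-punchOut)
open import Data.Fin.Subset using (Subset; inside; outside; ∁; ∣_∣)
open import Data.Fin.Subset.Properties using (anySubset?)
open import Data.Nat as ℕ using (ℕ; zero; suc; _∸_; z≤n; s≤s)
import Data.Nat.Properties as ℕₚ
open import Data.Sum using (inj₁; inj₂)
open import Data.Vec using ([]; _∷_; insertAt; removeAt; lookup)
open import Data.Vec.Properties
  using (lookup∘tabulate; tabulate∘lookup; tabulate-cong; lookup-map; insertAt-lookup;
         insertAt-punchIn; insertAt-removeAt; lookup⇒[]=; []=⇒lookup)
open import Function using (_∘_)
open import Function.Bundles using (_⇔_; mk⇔; Equivalence; _↔_; Inverse)
open import Function.Construct.Composition using (_⇔-∘_)
open import Function.Construct.Symmetry using (⇔-sym)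
open import Function.Properties.Inverse using (↔-refl; ↔-sym; ↔-trans)
open import Relation.Binary.Definitions using (Tri; tri<; tri≈; tri>)
open import Relation.Binary.PropositionalEquality
open import Relation.Nullary using (Dec; yes; no; ¬_)

module NorthSteps where
  open import Data.Nat using (_+_; _≤_)
  open import Data.Nat.Properties

  bit : Bool → ℕ
  bit true  = 1
  bit false = 0

  bit≤1 : ∀ x → bit x ≤ 1
  bit≤1 true  = s≤s z≤n
  bit≤1 false = z≤n

  north#-∷ : ∀ {n} x (s : Subset n) k → north# (x ∷ s) (suc k) ≡ bit x + north# s k
  north#-∷ true  s k = refl
  north#-∷ false s k = refl

  north#-0 : ∀ {n} (B : Subset n) → north# B 0 ≡ 0
  north#-0 []      = refl
  north#-0 (x ∷ B) = refl

  north#≤ : ∀ {n} (B : Subset n) k → north# B k ≤ k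
  north#≤ []      k       = z≤n
  north#≤ (x ∷ B) zero    = z≤n
  north#≤ (x ∷ B) (suc k) rewrite north#-∷ x B k = +-mono-≤ (bit≤1 x) (north#≤ B k)

  north#-mono : ∀ {n} (B : Subset n) {m k} → m ≤ k → north# B m ≤ north# B k
  north#-mono []      _ = z≤n
  north#-mono (x ∷ B) {zero} _ = z≤n
  north#-mono (x ∷ B) {suc m} {suc k} (s≤s m≤k) rewrite north#-∷ x B m | north#-∷ x B k =
    +-monoʳ-≤ (bit x) (north#-mono B m≤k)

  north#-lipschitz : ∀ {n} (B : Subset n) m k → north# B m ≤ north# B k + (m ∸ k)
  north#-lipschitz []      m       k       = z≤n
  north#-lipschitz (x ∷ B) zero    k       = z≤n
  north#-lipschitz (x ∷ B) (suc m) zero    = north#≤ (x ∷ B) (suc m)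
  north#-lipschitz (x ∷ B) (suc m) (suc k) rewrite north#-∷ x B m | north#-∷ x B k
    | +-assoc (bit x) (north# B k) (m ∸ k) = +-monoʳ-≤ (bit x) (north#-lipschitz B m k)

  north#-total : ∀ {n} (B : Subset n) → north# B n ≡ ∣ B ∣
  north#-total []            = refl
  north#-total (inside ∷ B)  = cong suc (north#-total B)
  north#-total (outside ∷ B) = north#-total B

  north#-∁ : ∀ {n} (B : Subset n) k → k ≤ n → north# (∁ B) k + north# B k ≡ k
  north#-∁ []            zero    _ = refl
  north#-∁ (x ∷ B)       zero    _ = refl
  north#-∁ (inside ∷ B)  (suc k) (s≤s k≤n) = trans (+-suc _ _) (cong suc (north#-∁ B k k≤n))
  north#-∁ (outside ∷ B) (suc k) (s≤s k≤n) = cong suc (north#-∁ B k k≤n)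

  north#-insertAt-≤ : ∀ {n} (B : Subset n) (e : Fin (suc n)) x k → k ≤ toℕ e →
    north# (insertAt B e x) k ≡ north# B k
  north#-insertAt-≤ B       Fin.zero    x zero    _ = sym (north#-0 B)
  north#-insertAt-≤ (y ∷ B) (Fin.suc e) x zero    _ = refl
  north#-insertAt-≤ (y ∷ B) (Fin.suc e) x (suc k) (s≤s k≤e) = begin
    north# (y ∷ insertAt B e x) (suc k) ≡⟨ north#-∷ y (insertAt B e x) k ⟩
    bit y + north# (insertAt B e x) k   ≡⟨ cong (bit y +_) (north#-insertAt-≤ B e x k k≤e) ⟩
    bit y + north# B k                  ≡⟨ north#-∷ y B k ⟨
    north# (y ∷ B) (suc k)              ∎
    where open ≡-Reasoning

  north#-insertAt-> : ∀ {n} (B : Subset n) (e : Fin (suc n)) x k → toℕ e ≤ k →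
    north# (insertAt B e x) (suc k) ≡ bit x + north# B k
  north#-insertAt-> B       Fin.zero    x k       _ = north#-∷ x B k
  north#-insertAt-> (y ∷ B) (Fin.suc e) x (suc k) (s≤s e≤k) = begin
    north# (y ∷ insertAt B e x) (suc (suc k)) ≡⟨ north#-∷ y (insertAt B e x) (suc k) ⟩
    bit y + north# (insertAt B e x) (suc k)   ≡⟨ cong (bit y +_) (north#-insertAt-> B e x k e≤k) ⟩
    bit y + (bit x + north# B k)              ≡⟨ x+[y+z]≡y+[x+z] (bit y) (bit x) _ ⟩
    bit x + (bit y + north# B k)              ≡⟨ cong (bit x +_) (north#-∷ y B k) ⟨
    bit x + north# (y ∷ B) (suc k)            ∎
    where
    open ≡-Reasoning
    x+[y+z]≡y+[x+z] : ∀ a b c → a + (b + c) ≡ b + (a + c)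
    x+[y+z]≡y+[x+z] a b c = trans (sym (+-assoc a b c)) (trans (cong (_+ c) (+-comm a b)) (+-assoc b a c))

open NorthSteps

open import Data.Integer using (ℤ; +_; -[1+_]; _+_; _-_; -_; _≤_; _⊔_; _⊓_; 0ℤ; 1ℤ; +≤+)
open import Data.Integer.Properties
open import Data.Integer.Tactic.RingSolver using (solve-∀)

≤-by-difference : ∀ {a b c d} → b - a ≡ d - c → c ≤ d → a ≤ b
≤-by-difference eq c≤d = 0≤i-j⇒j≤i (subst (+ 0 ≤_) (sym eq) (i≤j⇒0≤j-i c≤d))

i≤j+k⇒i-k≤j : ∀ {i j k} → i ≤ j + k → i - k ≤ j
i≤j+k⇒i-k≤j {i} {j} {k} = ≤-by-difference (rearrange i j k)
  where
  rearrange : ∀ (i j k : ℤ) → j - (i - k) ≡ (j + k) - i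
  rearrange = solve-∀

i-k≤j⇒i≤j+k : ∀ {i j k} → i - k ≤ j → i ≤ j + k
i-k≤j⇒i≤j+k {i} {j} {k} = ≤-by-difference (rearrange i j k)
  where
  rearrange : ∀ (i j k : ℤ) → (j + k) - i ≡ j - (i - k)
  rearrange = solve-∀

i+k≤j⇒i≤j-k : ∀ {i j k} → i + k ≤ j → i ≤ j - k
i+k≤j⇒i≤j-k {i} {j} {k} = ≤-by-difference (rearrange i j k)
  where
  rearrange : ∀ (i j k : ℤ) → (j - k) - i ≡ j - (i + k)
  rearrange = solve-∀

i≤j-k⇒i+k≤j : ∀ {i j k} → i ≤ j - k → i + k ≤ j
i≤j-k⇒i+k≤j {i} {j} {k} = ≤-by-difference (rearrange i j k)
  where
  rearrange : ∀ (i j k : ℤ) → j - (i + k) ≡ (j - k) - i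
  rearrange = solve-∀

+-cancelˡ-≤ : ∀ {i j} k → k + i ≤ k + j → i ≤ j
+-cancelˡ-≤ {i} {j} k = ≤-by-difference (rearrange i j k)
  where
  rearrange : ∀ (i j k : ℤ) → j - i ≡ (k + j) - (k + i)
  rearrange = solve-∀

+-cancelˡ-≡ : ∀ {i j} k → k + i ≡ k + j → i ≡ j
+-cancelˡ-≡ k eq = ≤-antisym (+-cancelˡ-≤ k (≤-reflexive eq)) (+-cancelˡ-≤ k (≤-reflexive (sym eq)))

+-cancelˡ-≤-+ : ∀ {m n} k → k + + m ≤ k + + n → m ℕ.≤ n
+-cancelˡ-≤-+ k = drop‿+≤+ ∘ +-cancelˡ-≤ k

i≤j⇒∃[n]j≡i++n : ∀ {i j} → i ≤ j → Σ[ n ∈ ℕ ] j ≡ i + + n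
i≤j⇒∃[n]j≡i++n {i} {j} i≤j =
  Data.Integer.∣ j - i ∣ ,
  trans (sym (i+[j-i]≡j i j)) (cong (λ t → i + t) (sym (0≤i⇒+∣i∣≡i (i≤j⇒0≤j-i i≤j))))
  where
  i+[j-i]≡j : ∀ (i j : ℤ) → i + (j - i) ≡ j
  i+[j-i]≡j = solve-∀

maxUpTo : ℕ → (ℕ → ℤ) → ℤ
maxUpTo zero    f = f 0
maxUpTo (suc n) f = maxUpTo n f ⊔ f (suc n)

f≤maxUpTo : ∀ n f {k} → k ℕ.≤ n → f k ≤ maxUpTo n f
f≤maxUpTo zero    f z≤n = ≤-refl
f≤maxUpTo (suc n) f k≤1+n with ℕₚ.m≤n⇒m<n∨m≡n k≤1+n
... | inj₁ (s≤s k≤n) = ≤-trans (f≤maxUpTo n f k≤n) (i≤i⊔j _ _)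
... | inj₂ refl      = i≤j⊔i _ _

maxUpTo-lub : ∀ n f {x} → (∀ k → k ℕ.≤ n → f k ≤ x) → maxUpTo n f ≤ x
maxUpTo-lub zero    f h = h 0 z≤n
maxUpTo-lub (suc n) f h =
  ⊔-lub (maxUpTo-lub n f (λ k k≤n → h k (ℕₚ.m≤n⇒m≤1+n k≤n))) (h (suc n) ℕₚ.≤-refl)

minUpTo : ℕ → (ℕ → ℤ) → ℤ
minUpTo zero    f = f 0
minUpTo (suc n) f = minUpTo n f ⊓ f (suc n)

minUpTo≤f : ∀ n f {k} → k ℕ.≤ n → minUpTo n f ≤ f k
minUpTo≤f zero    f z≤n = ≤-refl
minUpTo≤f (suc n) f k≤1+n with ℕₚ.m≤n⇒m<n∨m≡n k≤1+n
... | inj₁ (s≤s k≤n) = ≤-trans (i⊓j≤i _ _) (minUpTo≤f n f k≤n)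
... | inj₂ refl      = i⊓j≤j _ _

minUpTo-glb : ∀ n f {x} → (∀ k → k ℕ.≤ n → x ≤ f k) → x ≤ minUpTo n f
minUpTo-glb zero    f h = h 0 z≤n
minUpTo-glb (suc n) f h =
  ⊓-glb (minUpTo-glb n f (λ k k≤n → h k (ℕₚ.m≤n⇒m≤1+n k≤n))) (h (suc n) ℕₚ.≤-refl)

m∸n≤1+m∸[1+n] : ∀ m n → m ∸ n ℕ.≤ suc (m ∸ suc n)
m∸n≤1+m∸[1+n] zero    zero    = z≤n
m∸n≤1+m∸[1+n] zero    (suc n) = z≤n
m∸n≤1+m∸[1+n] (suc m) zero    = ℕₚ.≤-refl
m∸n≤1+m∸[1+n] (suc m) (suc n) = m∸n≤1+m∸[1+n] m n

1+m∸n≤1+[m∸n] : ∀ m n → suc m ∸ n ℕ.≤ suc (m ∸ n)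
1+m∸n≤1+[m∸n] m       zero    = ℕₚ.≤-refl
1+m∸n≤1+[m∸n] zero    (suc n) rewrite ℕₚ.0∸n≡0 n = z≤n
1+m∸n≤1+[m∸n] (suc m) (suc n) = 1+m∸n≤1+[m∸n] m n

-- Isomorphisms of set systems

≗-lookup⇒≡ : ∀ {n} {xs ys : Subset n} → (∀ i → lookup xs i ≡ lookup ys i) → xs ≡ ys
≗-lookup⇒≡ {xs = xs} {ys} eq =
  trans (sym (tabulate∘lookup xs)) (trans (tabulate-cong eq) (tabulate∘lookup ys))

lookup-image : ∀ {n m} (σ : Fin n ↔ Fin m) F y → lookup (image σ F) y ≡ lookup F (Inverse.from σ y)
lookup-image σ F = lookup∘tabulate _

≅-from-⇔ : ∀ {n} {𝓕 𝓖 : SetFamily n} → (∀ B → 𝓕 B ⇔ 𝓖 B) → mkSS n 𝓕 ≅ mkSS n 𝓖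
≅-from-⇔ {𝓕 = 𝓕} {𝓖} 𝓕⇔𝓖 = ↔-refl , λ B →
  subst (λ C → 𝓕 B ⇔ 𝓖 C) (sym (tabulate∘lookup B)) (𝓕⇔𝓖 B)

≅-trans : ∀ {S T R} → S ≅ T → T ≅ R → S ≅ R
≅-trans {S} {T} {R} (σ , σ-feasible) (τ , τ-feasible) = ↔-trans σ τ , λ F →
  subst (λ C → Feasible T (image σ F) ⇔ Feasible R C) (image-∘ F) (τ-feasible (image σ F))
    ⇔-∘ σ-feasible F
  where
  image-∘ : ∀ F → image τ (image σ F) ≡ image (↔-trans σ τ) F
  image-∘ F = ≗-lookup⇒≡ λ y → trans (lookup-image τ (image σ F) y)
    (trans (lookup-image σ F _) (sym (lookup-image (↔-trans σ τ) F y)))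

≅-proper : ∀ {S T} → S ≅ T → Proper T → Proper S
≅-proper {S} {T} (σ , σ-feasible) (G , G-feasible) =
  image (↔-sym σ) G ,
  Equivalence.from (σ-feasible (image (↔-sym σ) G)) (subst (Feasible T) (sym image-inverse) G-feasible)
  where
  image-inverse : image σ (image (↔-sym σ) G) ≡ G
  image-inverse = ≗-lookup⇒≡ λ y → trans (lookup-image σ (image (↔-sym σ) G) y)
    (trans (lookup-image (↔-sym σ) G _) (cong (lookup G) (Inverse.strictlyInverseˡ σ y)))

∁-involutive : ∀ {n} (B : Subset n) → ∁ (∁ B) ≡ B
∁-involutive []      = refl
∁-involutive (x ∷ B) = cong₂ _∷_ (not-involutive x) (∁-involutive B)

image-∁ : ∀ {n m} (σ : Fin n ↔ Fin m) F → image σ (∁ F) ≡ ∁ (image σ F)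
image-∁ σ F = ≗-lookup⇒≡ λ y → begin
  lookup (image σ (∁ F)) y         ≡⟨ lookup-image σ (∁ F) y ⟩
  lookup (∁ F) (Inverse.from σ y)  ≡⟨ lookup-map _ not F ⟩
  not (lookup F (Inverse.from σ y)) ≡⟨ cong not (lookup-image σ F y) ⟨
  not (lookup (image σ F) y)       ≡⟨ lookup-map y not (image σ F) ⟨
  lookup (∁ (image σ F)) y         ∎
  where open ≡-Reasoning

image-insertAt : ∀ {n m} (σ : Fin (suc n) ↔ Fin (suc m)) e x (F : Subset n) →
  image σ (insertAt F e x) ≡ insertAt (image (remove e σ) F) (Inverse.to σ e) x
image-insertAt {n} {m} σ e x F = ≗-lookup⇒≡ lookup-equal
  where
  open ≡-Reasoning
  τ : Fin n ↔ Fin m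
  τ = remove e σ
  σe : Fin (suc m)
  σe = Inverse.to σ e
  from-punchIn : ∀ z → Inverse.from σ (punchIn σe z) ≡ punchIn e (Inverse.from τ z)
  from-punchIn z = begin
    Inverse.from σ (punchIn σe z)
      ≡⟨ cong (Inverse.from σ ∘ punchIn σe) (inverseʳ τ) ⟨
    Inverse.from σ (punchIn σe (Inverse.to τ (Inverse.from τ z)))
      ≡⟨ cong (Inverse.from σ) (punchIn-permute σ e _) ⟨
    Inverse.from σ (Inverse.to σ (punchIn e (Inverse.from τ z)))
      ≡⟨ inverseˡ σ ⟩
    punchIn e (Inverse.from τ z)
      ∎
  lookup-equal : ∀ y → lookup (image σ (insertAt F e x)) y ≡ lookup (insertAt (image τ F) σe x) y
  lookup-equal y with y Data.Fin.Properties.≟ σe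
  ... | yes refl = begin
    lookup (image σ (insertAt F e x)) σe              ≡⟨ lookup-image σ (insertAt F e x) σe ⟩
    lookup (insertAt F e x) (Inverse.from σ σe)       ≡⟨ cong (lookup (insertAt F e x)) (inverseˡ σ) ⟩
    lookup (insertAt F e x) e                         ≡⟨ insertAt-lookup F e x ⟩
    x                                                 ≡⟨ insertAt-lookup (image τ F) σe x ⟨
    lookup (insertAt (image τ F) σe x) σe             ∎
  ... | no y≢σe = begin
    lookup (image σ (insertAt F e x)) y               ≡⟨ cong (lookup (image σ (insertAt F e x))) y≡punchIn ⟩
    lookup (image σ (insertAt F e x)) (punchIn σe z)  ≡⟨ lookup-image σ (insertAt F e x) (punchIn σe z) ⟩
    lookup (insertAt F e x) (Inverse.from σ (punchIn σe z)) ≡⟨ cong (lookup (insertAt F e x)) (from-punchIn z) ⟩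
    lookup (insertAt F e x) (punchIn e (Inverse.from τ z))  ≡⟨ insertAt-punchIn F e x _ ⟩
    lookup F (Inverse.from τ z)                       ≡⟨ lookup-image τ F z ⟨
    lookup (image τ F) z                              ≡⟨ insertAt-punchIn (image τ F) σe x z ⟨
    lookup (insertAt (image τ F) σe x) (punchIn σe z) ≡⟨ cong (lookup (insertAt (image τ F) σe x)) y≡punchIn ⟨
    lookup (insertAt (image τ F) σe x) y              ∎
    where
    z : Fin m
    z = punchOut (y≢σe ∘ sym)
    y≡punchIn : y ≡ punchIn σe z
    y≡punchIn = sym (punchIn-punchOut _)

-- Corridors

record Fits (N : ℕ) (lo hi : ℕ → ℤ) (h : ℕ → ℕ) : Set where
  constructor fits
  field
    shift   : ℤ
    between : ∀ k → k ℕ.≤ N → lo k ≤ shift + + h k × shift + + h k ≤ hi k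

Corridor : (N : ℕ) → (lo hi : ℕ → ℤ) → SetFamily N
Corridor N lo hi B = Fits N lo hi (north# B)

CorridorSystem : ℕ → (lo hi : ℕ → ℤ) → SetSystem
CorridorSystem N lo hi = mkSS N (Corridor N lo hi)

Fits-weaken : ∀ {N lo hi lo′ hi′ h} → (∀ k → k ℕ.≤ N → lo k ≤ lo′ k) →
  (∀ k → k ℕ.≤ N → hi′ k ≤ hi k) → Fits N lo′ hi′ h → Fits N lo hi h
Fits-weaken lo≤lo′ hi′≤hi (fits i f) = fits i λ k k≤N →
  ≤-trans (lo≤lo′ k k≤N) (proj₁ (f k k≤N)) , ≤-trans (proj₂ (f k k≤N)) (hi′≤hi k k≤N)

Fits-translate : ∀ {N lo hi lo′ hi′ h} a → (∀ k → k ℕ.≤ N → lo k ≡ a + lo′ k) →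
  (∀ k → k ℕ.≤ N → hi k ≡ a + hi′ k) → Fits N lo′ hi′ h → Fits N lo hi h
Fits-translate {h = h} a lo≡ hi≡ (fits i f) = fits (a + i) λ k k≤N →
  subst₂ _≤_ (sym (lo≡ k k≤N)) (reassoc k) (+-monoʳ-≤ a (proj₁ (f k k≤N))) ,
  subst₂ _≤_ (reassoc k) (sym (hi≡ k k≤N)) (+-monoʳ-≤ a (proj₂ (f k k≤N)))
  where
  reassoc : ∀ k → a + (i + + h k) ≡ a + i + + h k
  reassoc k = sym (+-assoc a i (+ h k))

Fits-translate-⇔ : ∀ {N lo hi lo′ hi′ h} a → (∀ k → k ℕ.≤ N → lo k ≡ a + lo′ k) →
  (∀ k → k ℕ.≤ N → hi k ≡ a + hi′ k) → Fits N lo hi h ⇔ Fits N lo′ hi′ h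
Fits-translate-⇔ a lo≡ hi≡ = mk⇔
  (Fits-translate (- a) (λ k k≤N → untranslate (lo≡ k k≤N)) (λ k k≤N → untranslate (hi≡ k k≤N)))
  (Fits-translate a lo≡ hi≡)
  where
  -a+[a+y]≡y : ∀ (a y : ℤ) → - a + (a + y) ≡ y
  -a+[a+y]≡y = solve-∀
  untranslate : ∀ {x y} → x ≡ a + y → y ≡ - a + x
  untranslate {y = y} refl = sym (-a+[a+y]≡y a y)

fits? : ∀ N lo hi h → Dec (Fits N lo hi h)
fits? N lo hi h with maxUpTo N (λ k → lo k - + h k) ≤? minUpTo N (λ k → hi k - + h k)
... | yes max≤min = yes (fits (maxUpTo N _) λ k k≤N →
  i-k≤j⇒i≤j+k (f≤maxUpTo N _ k≤N) , i≤j-k⇒i+k≤j (≤-trans max≤min (minUpTo≤f N _ k≤N)))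
... | no max≰min = no λ (fits i f) → max≰min (≤-trans
  (maxUpTo-lub N _ (λ k k≤N → i≤j+k⇒i-k≤j {j = i} (proj₁ (f k k≤N))))
  (minUpTo-glb N _ (λ k k≤N → i+k≤j⇒i≤j-k {i = i} (proj₂ (f k k≤N)))))

module _ (D : LPData) where
  open LPData D

  LPlower LPupper : ℕ → ℤ
  LPlower k = + north# P k
  LPupper k = + (d ℕ.+ north# Q k)

  LPFeasible⇒Corridor : ∀ B → LPFeasible D B → Corridor (u ℕ.+ v) LPlower LPupper B
  LPFeasible⇒Corridor B (i , _ , between , _) =
    fits (+ i) λ k k≤N → +≤+ (proj₁ (between k k≤N)) , +≤+ (proj₂ (between k k≤N))

  Corridor⇒LPFeasible : ∀ B → Corridor (u ℕ.+ v) LPlower LPupper B → LPFeasible D B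
  -- A negative shift violates the bound at k = 0, where both heights vanish.
  Corridor⇒LPFeasible B (fits -[1+ n ] f) with proj₁ (f 0 z≤n)
  ... | P₀≤ rewrite north#-0 P | north#-0 B with P₀≤
  ... | ()
  Corridor⇒LPFeasible B (fits (+ i) f) =
    i , i≤d , (λ k k≤N → drop‿+≤+ (proj₁ (f k k≤N)) , drop‿+≤+ (proj₂ (f k k≤N))) ,
    j , j≤c , i+∣B∣≡v-c+j
    where
    N : ℕ
    N = u ℕ.+ v
    i≤d : i ℕ.≤ d
    i≤d = subst₂ ℕ._≤_ (trans (cong (i ℕ.+_) (north#-0 B)) (ℕₚ.+-identityʳ i))
            (trans (cong (d ℕ.+_) (north#-0 Q)) (ℕₚ.+-identityʳ d)) (drop‿+≤+ (proj₂ (f 0 z≤n)))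
    v-c≤i+∣B∣ : v ∸ c ℕ.≤ i ℕ.+ ∣ B ∣
    v-c≤i+∣B∣ = subst₂ ℕ._≤_ (trans (north#-total P) P-ends) (cong (i ℕ.+_) (north#-total B))
                  (drop‿+≤+ (proj₁ (f N ℕₚ.≤-refl)))
    i+∣B∣≤v : i ℕ.+ ∣ B ∣ ℕ.≤ v
    i+∣B∣≤v = subst₂ ℕ._≤_ (cong (i ℕ.+_) (north#-total B))
                (trans (cong (d ℕ.+_) (trans (north#-total Q) Q-ends)) (ℕₚ.m+[n∸m]≡n d≤v))
                (drop‿+≤+ (proj₂ (f N ℕₚ.≤-refl)))
      where
      d≤v : d ℕ.≤ v
      d≤v = ℕₚ.≤-trans (ℕₚ.m≤n+m d c) cd≤v
    j : ℕ
    j = (i ℕ.+ ∣ B ∣) ∸ (v ∸ c)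
    j≤c : j ℕ.≤ c
    j≤c = subst (j ℕ.≤_) (ℕₚ.m∸[m∸n]≡n (ℕₚ.≤-trans (ℕₚ.m≤m+n c d) cd≤v))
            (ℕₚ.∸-monoˡ-≤ (v ∸ c) i+∣B∣≤v)
    i+∣B∣≡v-c+j : i ℕ.+ ∣ B ∣ ≡ (v ∸ c) ℕ.+ j
    i+∣B∣≡v-c+j = sym (ℕₚ.m+[n∸m]≡n v-c≤i+∣B∣)

  LPFeasible⇔Corridor : ∀ B → LPFeasible D B ⇔ Corridor (u ℕ.+ v) LPlower LPupper B
  LPFeasible⇔Corridor B = mk⇔ (LPFeasible⇒Corridor B) (Corridor⇒LPFeasible B)

-- From corridors to lattice path data

Staircase : (ℕ → ℤ) → Set
Staircase f = ∀ k → f k ≤ f (suc k) × f (suc k) ≤ f k + 1ℤ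

staircase⇒path : ∀ n {f} → Staircase f →
  Σ[ P ∈ Subset n ] (∀ k → k ℕ.≤ n → f k ≡ f 0 + + north# P k)
staircase⇒path zero    {f} stair = [] , λ { .zero z≤n → sym (+-identityʳ (f 0)) }
staircase⇒path (suc n) {f} stair
  with staircase⇒path n (stair ∘ suc) | i≤j⇒∃[n]j≡i++n (proj₁ (stair 0))
... | P , f∘suc≡ | t , f₁≡f₀+t = x ∷ P , f≡
  where
  t≤1 : t ℕ.≤ 1
  t≤1 = +-cancelˡ-≤-+ (f 0) (subst (_≤ f 0 + 1ℤ) f₁≡f₀+t (proj₂ (stair 0)))
  bitOf : ∀ t → t ℕ.≤ 1 → Σ[ x ∈ Bool ] bit x ≡ t
  bitOf zero          _           = false , refl
  bitOf (suc zero)    _           = true , refl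
  bitOf (suc (suc t)) (s≤s ())
  x : Bool
  x = proj₁ (bitOf t t≤1)
  f≡ : ∀ k → k ℕ.≤ suc n → f k ≡ f 0 + + north# (x ∷ P) k
  f≡ zero    _ = sym (+-identityʳ (f 0))
  f≡ (suc k) (s≤s k≤n) = begin
    f (suc k)                         ≡⟨ f∘suc≡ k k≤n ⟩
    f 1 + + north# P k                ≡⟨ cong (λ y → y + + north# P k) f₁≡f₀+t ⟩
    f 0 + + t + + north# P k          ≡⟨ cong (λ s → f 0 + + s + + north# P k) (proj₂ (bitOf t t≤1)) ⟨
    f 0 + + bit x + + north# P k      ≡⟨ +-assoc (f 0) _ _ ⟩
    f 0 + + (bit x ℕ.+ north# P k)    ≡⟨ cong (λ s → f 0 + + s) (north#-∷ x P k) ⟨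
    f 0 + + north# (x ∷ P) (suc k)    ∎
    where open ≡-Reasoning

staircase-mono : ∀ {f} → Staircase f → ∀ {k m} → k ℕ.≤ m → f k ≤ f m
staircase-mono stair {m = zero}  z≤n   = ≤-refl
staircase-mono stair {m = suc m} k≤1+m with ℕₚ.m≤n⇒m<n∨m≡n k≤1+m
... | inj₁ (s≤s k≤m) = ≤-trans (staircase-mono stair k≤m) (proj₁ (stair m))
... | inj₂ refl      = ≤-refl

translate≅LPSystem : ∀ {N L U} (D : LPData) a → LPData.u D ℕ.+ LPData.v D ≡ N →
  (∀ k → k ℕ.≤ N → L k ≡ a + LPlower D k) → (∀ k → k ℕ.≤ N → U k ≡ a + LPupper D k) →
  CorridorSystem N L U ≅ LPSystem D
translate≅LPSystem D a refl L≡ U≡ =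
  ≅-from-⇔ λ B → ⇔-sym (LPFeasible⇔Corridor D B) ⇔-∘ Fits-translate-⇔ a L≡ U≡

-- The last two hypotheses say d ≤ v - c and v ≤ N for the data read off below.
module _ {N} {L U : ℕ → ℤ} (L-stair : Staircase L) (U-stair : Staircase U)
         (L≤U : ∀ k → k ℕ.≤ N → L k ≤ U k) (U₀≤L[N] : U 0 ≤ L N) (U[N]≤L₀+N : U N ≤ L 0 + + N) where

  private
    a : ℤ
    a = L 0
    d : ℕ
    d = proj₁ (i≤j⇒∃[n]j≡i++n (L≤U 0 z≤n))
    U₀≡a+d : U 0 ≡ a + + d
    U₀≡a+d = proj₂ (i≤j⇒∃[n]j≡i++n (L≤U 0 z≤n))
    p : ℕ
    p = proj₁ (i≤j⇒∃[n]j≡i++n (staircase-mono L-stair (z≤n {N})))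
    L[N]≡a+p : L N ≡ a + + p
    L[N]≡a+p = proj₂ (i≤j⇒∃[n]j≡i++n (staircase-mono L-stair (z≤n {N})))
    q : ℕ
    q = proj₁ (i≤j⇒∃[n]j≡i++n (staircase-mono U-stair (z≤n {N})))
    U[N]≡a+d+q : U N ≡ a + + (d ℕ.+ q)
    U[N]≡a+d+q = trans (proj₂ (i≤j⇒∃[n]j≡i++n (staircase-mono U-stair (z≤n {N}))))
      (trans (cong (_+ + q) U₀≡a+d) (+-assoc a (+ d) (+ q)))
    v c u : ℕ
    v = d ℕ.+ q
    c = v ∸ p
    u = N ∸ v
    d≤p : d ℕ.≤ p
    d≤p = +-cancelˡ-≤-+ a (subst₂ _≤_ U₀≡a+d L[N]≡a+p U₀≤L[N])
    p≤v : p ℕ.≤ v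
    p≤v = +-cancelˡ-≤-+ a (subst₂ _≤_ L[N]≡a+p U[N]≡a+d+q (L≤U N ℕₚ.≤-refl))
    u+v≡N : u ℕ.+ v ≡ N
    u+v≡N = ℕₚ.m∸n+n≡m (+-cancelˡ-≤-+ a (subst (_≤ a + + N) U[N]≡a+d+q U[N]≤L₀+N))
    toN : ∀ {k} → k ℕ.≤ u ℕ.+ v → k ℕ.≤ N
    toN {k} = subst (k ℕ.≤_) u+v≡N
    P : Subset (u ℕ.+ v)
    P = proj₁ (staircase⇒path (u ℕ.+ v) L-stair)
    L≡a+P : ∀ k → k ℕ.≤ u ℕ.+ v → L k ≡ a + + north# P k
    L≡a+P = proj₂ (staircase⇒path (u ℕ.+ v) L-stair)
    Q : Subset (u ℕ.+ v)
    Q = proj₁ (staircase⇒path (u ℕ.+ v) U-stair)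
    U≡a+d+Q : ∀ k → k ℕ.≤ u ℕ.+ v → U k ≡ a + + (d ℕ.+ north# Q k)
    U≡a+d+Q k k≤N = trans (proj₂ (staircase⇒path (u ℕ.+ v) U-stair) k k≤N)
      (trans (cong (_+ + north# Q k) U₀≡a+d) (+-assoc a (+ d) (+ north# Q k)))
    ∣P∣≡p : ∣ P ∣ ≡ p
    ∣P∣≡p = +-injective (+-cancelˡ-≡ a (begin
      a + + ∣ P ∣               ≡⟨ cong (λ s → a + + s) (north#-total P) ⟨
      a + + north# P (u ℕ.+ v)  ≡⟨ L≡a+P (u ℕ.+ v) ℕₚ.≤-refl ⟨
      L (u ℕ.+ v)               ≡⟨ cong L u+v≡N ⟩
      L N                       ≡⟨ L[N]≡a+p ⟩
      a + + p                   ∎))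
      where open ≡-Reasoning
    ∣Q∣≡q : ∣ Q ∣ ≡ q
    ∣Q∣≡q = ℕₚ.+-cancelˡ-≡ d _ _ (+-injective (+-cancelˡ-≡ a (begin
      a + + (d ℕ.+ ∣ Q ∣)              ≡⟨ cong (λ s → a + + (d ℕ.+ s)) (north#-total Q) ⟨
      a + + (d ℕ.+ north# Q (u ℕ.+ v)) ≡⟨ U≡a+d+Q (u ℕ.+ v) ℕₚ.≤-refl ⟨
      U (u ℕ.+ v)                      ≡⟨ cong U u+v≡N ⟩
      U N                              ≡⟨ U[N]≡a+d+q ⟩
      a + + (d ℕ.+ q)                  ∎)))
      where open ≡-Reasoning

    D : LPData
    D = record
      { u = u ; v = v ; c = c ; d = d
      ; cd≤v = ℕₚ.≤-trans (ℕₚ.+-monoʳ-≤ c d≤p) (ℕₚ.≤-reflexive (ℕₚ.m∸n+n≡m p≤v))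
      ; P = P
      ; P-ends = trans ∣P∣≡p (sym (ℕₚ.m∸[m∸n]≡n p≤v))
      ; Q = Q
      ; Q-ends = trans ∣Q∣≡q (sym (ℕₚ.m+n∸m≡n d q))
      ; noncross = λ k k≤N →
          +-cancelˡ-≤-+ a (subst₂ _≤_ (L≡a+P k k≤N) (U≡a+d+Q k k≤N) (L≤U k (toN k≤N)))
      }

  staircaseCorridor≅LPSystem : Σ[ D ∈ LPData ] CorridorSystem N L U ≅ LPSystem D
  staircaseCorridor≅LPSystem = D , translate≅LPSystem D a u+v≡N
    (λ k k≤N → L≡a+P k (subst (k ℕ.≤_) (sym u+v≡N) k≤N))
    (λ k k≤N → U≡a+d+Q k (subst (k ℕ.≤_) (sym u+v≡N) k≤N))

module Envelope (N : ℕ) (lo hi : ℕ → ℤ) where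

  -- Heights never decrease and grow by at most one per step, so lower k is the least height on
  -- antidiagonal k compatible with lo everywhere, and dually for upper. The two caps in cap never
  -- bind for the least admissible shift (see fits-envelope); they make the end points of the
  -- envelopes line up.
  lower : ℕ → ℤ
  lower k = maxUpTo N (λ m → lo m - + (m ∸ k))

  cap : ℕ → ℤ
  cap m = hi m ⊓ (lower N + + m) ⊓ (lower 0 + + N)

  upper : ℕ → ℤ
  upper k = minUpTo N (λ m → cap m + + (k ∸ m))

  lower-staircase : Staircase lower
  lower-staircase k = mono , step
    where
    mono : lower k ≤ lower (suc k)
    mono = maxUpTo-lub N _ λ m m≤N →
      ≤-trans (+-monoʳ-≤ (lo m) (neg-mono-≤ (+≤+ (ℕₚ.∸-monoʳ-≤ m (ℕₚ.n≤1+n k)))))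
              (f≤maxUpTo N _ m≤N)
    rearrange : ∀ (l x y y′ : ℤ) → (l + 1ℤ) - (x - y′) ≡ (l + (1ℤ + y′)) - ((x - y) + y)
    rearrange = solve-∀
    step : lower (suc k) ≤ lower k + 1ℤ
    step = maxUpTo-lub N _ λ m m≤N →
      ≤-by-difference (rearrange (lower k) (lo m) (+ (m ∸ k)) (+ (m ∸ suc k)))
        (+-mono-≤ (f≤maxUpTo N (λ m → lo m - + (m ∸ k)) m≤N) (+≤+ (m∸n≤1+m∸[1+n] m k)))

  upper-staircase : Staircase upper
  upper-staircase k = mono , step
    where
    mono : upper k ≤ upper (suc k)
    mono = minUpTo-glb N _ λ m m≤N →
      ≤-trans (minUpTo≤f N _ m≤N) (+-monoʳ-≤ (cap m) (+≤+ (ℕₚ.∸-monoˡ-≤ m (ℕₚ.n≤1+n k))))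
    rearrange : ∀ (x y : ℤ) → x + (1ℤ + y) ≡ (x + y) + 1ℤ
    rearrange = solve-∀
    step : upper (suc k) ≤ upper k + 1ℤ
    step = i-k≤j⇒i≤j+k (minUpTo-glb N _ λ m m≤N → i≤j+k⇒i-k≤j (subst (upper (suc k) ≤_)
      (rearrange (cap m) (+ (k ∸ m)))
      (≤-trans (minUpTo≤f N _ m≤N) (+-monoʳ-≤ (cap m) (+≤+ (1+m∸n≤1+[m∸n] k m))))))

  lo≤lower : ∀ k → k ℕ.≤ N → lo k ≤ lower k
  lo≤lower k k≤N with f≤maxUpTo N (λ m → lo m - + (m ∸ k)) k≤N
  ... | lo[k]≤lower[k] rewrite ℕₚ.n∸n≡0 k | +-identityʳ (lo k) = lo[k]≤lower[k]

  upper≤cap : ∀ k → k ℕ.≤ N → upper k ≤ cap k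
  upper≤cap k k≤N with minUpTo≤f N (λ m → cap m + + (k ∸ m)) k≤N
  ... | upper[k]≤cap[k] rewrite ℕₚ.n∸n≡0 k | +-identityʳ (cap k) = upper[k]≤cap[k]

  upper≤hi : ∀ k → k ℕ.≤ N → upper k ≤ hi k
  upper≤hi k k≤N = ≤-trans (upper≤cap k k≤N) (≤-trans (i⊓j≤i _ _) (i⊓j≤i _ _))

  module _ {B : Subset N} where
    private
      h : ℕ → ℤ
      h k = + north# B k

      h-lipschitz : ∀ m k → h m ≤ h k + + (m ∸ k)
      h-lipschitz m k = +≤+ (north#-lipschitz B m k)

    lower≤ : ∀ i → (∀ m → m ℕ.≤ N → lo m ≤ i + h m) → ∀ k → lower k ≤ i + h k
    lower≤ i lo≤ k = maxUpTo-lub N _ λ m m≤N → i≤j+k⇒i-k≤j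
      (≤-trans (lo≤ m m≤N) (≤-trans (+-monoʳ-≤ i (h-lipschitz m k)) (≤-reflexive (sym (+-assoc i _ _)))))

    ≤upper : ∀ i → (∀ m → m ℕ.≤ N → i + h m ≤ cap m) → ∀ k → i + h k ≤ upper k
    ≤upper i ≤cap k = minUpTo-glb N _ λ m m≤N →
      ≤-trans (≤-trans (+-monoʳ-≤ i (h-lipschitz k m)) (≤-reflexive (sym (+-assoc i _ _))))
              (+-monoˡ-≤ _ (≤cap m m≤N))

    fits-envelope : Fits N lo hi (north# B) → Fits N lower upper (north# B)
    fits-envelope (fits i between) = fits i* λ k _ → lower≤ i* lo≤ k , ≤upper i* ≤cap k
      where
      i* : ℤ
      i* = maxUpTo N (λ m → lo m - h m)
      lo≤ : ∀ m → m ℕ.≤ N → lo m ≤ i* + h m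
      lo≤ m m≤N = i-k≤j⇒i≤j+k (f≤maxUpTo N _ m≤N)
      i*≤i : i* ≤ i
      i*≤i = maxUpTo-lub N _ λ m m≤N → i≤j+k⇒i-k≤j (proj₁ (between m m≤N))
      i*≤lower[N] : i* ≤ lower N
      i*≤lower[N] = maxUpTo-lub N _ λ m m≤N →
        ≤-trans (i≤j⇒i-k≤j (h m) ≤-refl)
                (≤-trans (lo≤lower m m≤N) (staircase-mono lower-staircase m≤N))
      rearrange : ∀ (l m n′ hN hm x : ℤ) →
        ((l + (m + n′)) - hN) - (x - hm) ≡ (l + (hm + n′)) - ((x - m) + hN)
      rearrange = solve-∀
      i*+h[N]≤lower₀+N : i* + h N ≤ lower 0 + + N
      i*+h[N]≤lower₀+N = i≤j-k⇒i+k≤j (maxUpTo-lub N _ λ m m≤N →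
        subst (λ n → lo m - h m ≤ (lower 0 + n) - h N)
              (trans (sym (pos-+ m (N ∸ m))) (cong +_ (ℕₚ.m+[n∸m]≡n m≤N)))
          (≤-by-difference (rearrange (lower 0) (+ m) (+ (N ∸ m)) (h N) (h m) (lo m))
            (+-mono-≤ (f≤maxUpTo N (λ m → lo m - + (m ∸ 0)) m≤N) (h-lipschitz N m))))
      ≤cap : ∀ m → m ℕ.≤ N → i* + h m ≤ cap m
      ≤cap m m≤N = ⊓-glb (⊓-glb (≤-trans (+-monoˡ-≤ (h m) i*≤i) (proj₂ (between m m≤N)))
                                (+-mono-≤ i*≤lower[N] (+≤+ (north#≤ B m))))
                         (≤-trans (+-monoʳ-≤ i* (+≤+ (north#-mono B m≤N))) i*+h[N]≤lower₀+N)

  fits-envelope-⇔ : ∀ B → Fits N lo hi (north# B) ⇔ Fits N lower upper (north# B)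
  fits-envelope-⇔ B = mk⇔ (fits-envelope {B}) (Fits-weaken lo≤lower upper≤hi)

  upper₀≤lower[N] : upper 0 ≤ lower N
  upper₀≤lower[N] =
    ≤-trans (upper≤cap 0 z≤n) (≤-trans (i⊓j≤i _ _) (≤-trans (i⊓j≤j _ _) (≤-reflexive (+-identityʳ _))))

  upper[N]≤lower₀+N : upper N ≤ lower 0 + + N
  upper[N]≤lower₀+N = ≤-trans (upper≤cap N ℕₚ.≤-refl) (i⊓j≤j _ _)

  lower≤upper : ∀ B → Fits N lo hi (north# B) → ∀ k → k ℕ.≤ N → lower k ≤ upper k
  lower≤upper B B-fits k k≤N = ≤-trans (proj₁ (between k k≤N)) (proj₂ (between k k≤N))
    where open Fits (fits-envelope {B} B-fits)

properCorridor⇒LatticePathDM : ∀ {N lo hi} →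
  Proper (CorridorSystem N lo hi) → IsLatticePathDM (CorridorSystem N lo hi)
properCorridor⇒LatticePathDM {N} {lo} {hi} (B , B-fits) =
  let D , envelope≅D = staircaseCorridor≅LPSystem lower-staircase upper-staircase
                         (lower≤upper B B-fits) upper₀≤lower[N] upper[N]≤lower₀+N
  in D , ≅-trans {T = CorridorSystem N lower upper} {LPSystem D} (≅-from-⇔ fits-envelope-⇔) envelope≅D
  where open Envelope N lo hi

-- Duals and minors

reflect : (ℕ → ℤ) → ℕ → ℤ
reflect f k = + k - f k

Fits-∁ : ∀ {N lo hi} B → Fits N lo hi (north# (∁ B)) → Fits N (reflect hi) (reflect lo) (north# B)
Fits-∁ {N} {lo} {hi} B (fits i between) = fits (- i) λ k k≤N →
  reflect-upper i (+ k) (+ north# B k)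
    (subst (λ t → i + t ≤ hi k) (north#-∁-ℤ k k≤N) (proj₂ (between k k≤N))) ,
  reflect-lower i (+ k) (+ north# B k)
    (subst (λ t → lo k ≤ i + t) (north#-∁-ℤ k k≤N) (proj₁ (between k k≤N)))
  where
  north#-∁-ℤ : ∀ k → k ℕ.≤ N → + north# (∁ B) k ≡ + k - + north# B k
  north#-∁-ℤ k k≤N = begin
    + n∁ k                          ≡⟨ [x+y]-y≡x (+ n∁ k) (+ n k) ⟨
    + n∁ k + + n k - + n k          ≡⟨ cong (λ s → s - + n k) (pos-+ (n∁ k) (n k)) ⟨
    + (n∁ k ℕ.+ n k) - + n k        ≡⟨ cong (λ s → + s - + n k) (north#-∁ B k k≤N) ⟩
    + k - + n k                     ∎
    where
    open ≡-Reasoning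
    [x+y]-y≡x : ∀ (x y : ℤ) → x + y - y ≡ x
    [x+y]-y≡x = solve-∀
    n n∁ : ℕ → ℕ
    n = north# B
    n∁ = north# (∁ B)
  rearrange-upper : ∀ (i k n b : ℤ) → (- i + n) - (k - b) ≡ b - (i + (k - n))
  rearrange-upper = solve-∀
  reflect-upper : ∀ i k n {b} → i + (k - n) ≤ b → k - b ≤ - i + n
  reflect-upper i k n {b} = ≤-by-difference (rearrange-upper i k n b)
  rearrange-lower : ∀ (i k n a : ℤ) → (k - a) - (- i + n) ≡ (i + (k - n)) - a
  rearrange-lower = solve-∀
  reflect-lower : ∀ i k n {a} → a ≤ i + (k - n) → - i + n ≤ k - a
  reflect-lower i k n {a} = ≤-by-difference (rearrange-lower i k n a)

Fits-∁-⇔ : ∀ {N lo hi} B → Fits N lo hi (north# (∁ B)) ⇔ Fits N (reflect hi) (reflect lo) (north# B)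
Fits-∁-⇔ {N} {lo} {hi} B = mk⇔ (Fits-∁ B) λ B-fits → Fits-translate 0ℤ reflect-reflect reflect-reflect
  (Fits-∁ (∁ B) (subst (λ C → Fits N (reflect hi) (reflect lo) (north# C)) (sym (∁-involutive B)) B-fits))
  where
  k-[k-x]≡0+x : ∀ (k x : ℤ) → x ≡ 0ℤ + (k - (k - x))
  k-[k-x]≡0+x = solve-∀
  reflect-reflect : ∀ {f} k → k ℕ.≤ N → f k ≡ 0ℤ + reflect (reflect f) k
  reflect-reflect {f} k _ = k-[k-x]≡0+x (+ k) (f k)

-- Fixing step p of a path to X: heights on antidiagonals k ≤ p are unchanged, and antidiagonal
-- k + 1 of the long path becomes antidiagonal k of the short one, shifted by X.
module Merge (p : ℕ) (X : ℤ) (lo hi : ℕ → ℤ) where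

  pick : ∀ {k} → Tri (k ℕ.< p) (k ≡ p) (p ℕ.< k) → ℤ → ℤ → ℤ → ℤ
  pick (tri< _ _ _) before _   _     = before
  pick (tri≈ _ _ _) _      at  _     = at
  pick (tri> _ _ _) _      _   after = after

  lo′ hi′ : ℕ → ℤ
  lo′ k = pick (ℕₚ.<-cmp k p) (lo k) (lo k ⊔ (lo (suc k) - X)) (lo (suc k) - X)
  hi′ k = pick (ℕₚ.<-cmp k p) (hi k) (hi k ⊓ (hi (suc k) - X)) (hi (suc k) - X)

  lo′≤⇔ : ∀ k t → lo′ k ≤ t ⇔ ((k ℕ.≤ p → lo k ≤ t) × (p ℕ.≤ k → lo (suc k) - X ≤ t))
  lo′≤⇔ k t with ℕₚ.<-cmp k p
  ... | tri< k<p _ _ = mk⇔ (λ le → (λ _ → le) , λ p≤k → ⊥-elim (ℕₚ.<⇒≱ k<p p≤k))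
                           (λ h → proj₁ h (ℕₚ.<⇒≤ k<p))
  ... | tri≈ _ k≡p _ = mk⇔ (λ le → (λ _ → ≤-trans (i≤i⊔j _ _) le) , λ _ → ≤-trans (i≤j⊔i _ _) le)
                           (λ h → ⊔-lub (proj₁ h (ℕₚ.≤-reflexive k≡p)) (proj₂ h (ℕₚ.≤-reflexive (sym k≡p))))
  ... | tri> _ _ p<k = mk⇔ (λ le → (λ k≤p → ⊥-elim (ℕₚ.<⇒≱ p<k k≤p)) , λ _ → le)
                           (λ h → proj₂ h (ℕₚ.<⇒≤ p<k))

  ≤hi′⇔ : ∀ k t → t ≤ hi′ k ⇔ ((k ℕ.≤ p → t ≤ hi k) × (p ℕ.≤ k → t ≤ hi (suc k) - X))
  ≤hi′⇔ k t with ℕₚ.<-cmp k p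
  ... | tri< k<p _ _ = mk⇔ (λ le → (λ _ → le) , λ p≤k → ⊥-elim (ℕₚ.<⇒≱ k<p p≤k))
                           (λ h → proj₁ h (ℕₚ.<⇒≤ k<p))
  ... | tri≈ _ k≡p _ = mk⇔ (λ le → (λ _ → ≤-trans le (i⊓j≤i _ _)) , λ _ → ≤-trans le (i⊓j≤j _ _))
                           (λ h → ⊓-glb (proj₁ h (ℕₚ.≤-reflexive k≡p)) (proj₂ h (ℕₚ.≤-reflexive (sym k≡p))))
  ... | tri> _ _ p<k = mk⇔ (λ le → (λ k≤p → ⊥-elim (ℕₚ.<⇒≱ p<k k≤p)) , λ _ → le)
                           (λ h → proj₂ h (ℕₚ.<⇒≤ p<k))

Fits-insertAt-⇔ : ∀ {m lo hi} (e : Fin (suc m)) x (B : Subset m) →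
  Fits (suc m) lo hi (north# (insertAt B e x)) ⇔
  Fits m (Merge.lo′ (toℕ e) (+ bit x) lo hi) (Merge.hi′ (toℕ e) (+ bit x) lo hi) (north# B)
Fits-insertAt-⇔ {m} {lo} {hi} e x B = mk⇔ to from
  where
  p : ℕ
  p = toℕ e
  X : ℤ
  X = + bit x
  open Merge p X lo hi
  h h′ : ℕ → ℤ
  h k = + north# B k
  h′ k = + north# (insertAt B e x) k
  p≤m : p ℕ.≤ m
  p≤m = toℕ≤pred[n] e
  h′-before : ∀ k → k ℕ.≤ p → h′ k ≡ h k
  h′-before k k≤p = cong +_ (north#-insertAt-≤ B e x k k≤p)
  rearrange : ∀ (i X y : ℤ) → i + (X + y) ≡ (i + y) + X
  rearrange = solve-∀
  h′-after : ∀ k → p ℕ.≤ k → ∀ i → i + h′ (suc k) ≡ (i + h k) + X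
  h′-after k p≤k i =
    trans (cong (λ t → i + t) (trans (cong +_ (north#-insertAt-> B e x k p≤k)) (pos-+ (bit x) _)))
          (rearrange i X (h k))

  to : Fits (suc m) lo hi (north# (insertAt B e x)) → Fits m lo′ hi′ (north# B)
  to (fits i between) = fits i λ k k≤m →
    Equivalence.from (lo′≤⇔ k _)
      ( (λ k≤p → subst (λ t → lo k ≤ i + t) (h′-before k k≤p) (proj₁ (between k (ℕₚ.m≤n⇒m≤1+n k≤m))))
      , (λ p≤k → i≤j+k⇒i-k≤j
          (subst (lo (suc k) ≤_) (h′-after k p≤k i) (proj₁ (between (suc k) (s≤s k≤m)))))) ,
    Equivalence.from (≤hi′⇔ k _)
      ( (λ k≤p → subst (λ t → i + t ≤ hi k) (h′-before k k≤p) (proj₂ (between k (ℕₚ.m≤n⇒m≤1+n k≤m))))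
      , (λ p≤k → i+k≤j⇒i≤j-k
          (subst (_≤ hi (suc k)) (h′-after k p≤k i) (proj₂ (between (suc k) (s≤s k≤m))))))

  from : Fits m lo′ hi′ (north# B) → Fits (suc m) lo hi (north# (insertAt B e x))
  from (fits i between) = fits i between′
    where
    between′ : ∀ k → k ℕ.≤ suc m → lo k ≤ i + h′ k × i + h′ k ≤ hi k
    between′ k _ with k ℕₚ.≤? p
    between′ k _ | yes k≤p =
      subst (λ t → lo k ≤ i + t) (sym (h′-before k k≤p))
        (proj₁ (Equivalence.to (lo′≤⇔ k _) (proj₁ (between k (ℕₚ.≤-trans k≤p p≤m)))) k≤p) ,
      subst (λ t → i + t ≤ hi k) (sym (h′-before k k≤p))
        (proj₁ (Equivalence.to (≤hi′⇔ k _) (proj₂ (between k (ℕₚ.≤-trans k≤p p≤m)))) k≤p)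
    between′ zero    _         | no 0≰p = ⊥-elim (0≰p z≤n)
    between′ (suc k) (s≤s k≤m) | no 1+k≰p =
      subst (lo (suc k) ≤_) (sym (h′-after k p≤k i))
        (i-k≤j⇒i≤j+k (proj₂ (Equivalence.to (lo′≤⇔ k _) (proj₁ (between k k≤m))) p≤k)) ,
      subst (_≤ hi (suc k)) (sym (h′-after k p≤k i))
        (i≤j-k⇒i+k≤j (proj₂ (Equivalence.to (≤hi′⇔ k _) (proj₂ (between k k≤m))) p≤k))
      where
      p≤k : p ℕ.≤ k
      p≤k = ℕₚ.≤-pred (ℕₚ.≰⇒> 1+k≰p)

IsCorridorSystem : SetSystem → Set
IsCorridorSystem S = Σ[ N ∈ ℕ ] Σ[ lo ∈ (ℕ → ℤ) ] Σ[ hi ∈ (ℕ → ℤ) ] S ≅ CorridorSystem N lo hi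

LatticePathDM⇒CorridorSystem : ∀ {S} → IsLatticePathDM S → IsCorridorSystem S
LatticePathDM⇒CorridorSystem {S} (D , S≅D) = u ℕ.+ v , LPlower D , LPupper D ,
  ≅-trans {S} {LPSystem D} {CorridorSystem (u ℕ.+ v) (LPlower D) (LPupper D)}
          S≅D (≅-from-⇔ (LPFeasible⇔Corridor D))
  where open LPData D

LatticePathDM⇒Proper : ∀ {S} → IsLatticePathDM S → Proper S
LatticePathDM⇒Proper {S} (D , S≅D) =
  ≅-proper {S} {LPSystem D} S≅D
    (P , 0 , z≤n , (λ k k≤N → ℕₚ.≤-refl , noncross k k≤N) , 0 , z≤n , trans P-ends (sym (ℕₚ.+-identityʳ _)))
  where open LPData D

properCorridorSystem⇒LatticePathDM : ∀ {S} → IsCorridorSystem S → Proper S → IsLatticePathDM S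
properCorridorSystem⇒LatticePathDM {S} (N , lo , hi , σ , σ-feasible) (F , F-feasible) =
  let D , corridor≅D = properCorridor⇒LatticePathDM (image σ F , Equivalence.to (σ-feasible F) F-feasible)
  in D , ≅-trans {S} {CorridorSystem N lo hi} {LPSystem D} (σ , σ-feasible) corridor≅D

CorridorSystem-dual : ∀ {S} → IsCorridorSystem S → IsCorridorSystem (dual S)
CorridorSystem-dual (N , lo , hi , σ , σ-feasible) = N , reflect hi , reflect lo , σ , λ F →
  Fits-∁-⇔ (image σ F) ⇔-∘ subst (λ C → _ ⇔ Corridor N lo hi C) (image-∁ σ F) (σ-feasible (∁ F))

Proper-dual : ∀ {S} → Proper S → Proper (dual S)
Proper-dual {S} (F , F-feasible) = ∁ F , subst (Feasible S) (sym (∁-involutive F)) F-feasible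

CorridorSystem-insertAt : ∀ {n} {𝓕 : SetFamily (suc n)} e x → IsCorridorSystem (mkSS (suc n) 𝓕) →
  IsCorridorSystem (mkSS n (λ F → 𝓕 (insertAt F e x)))
CorridorSystem-insertAt e x (zero , lo , hi , σ , σ-feasible) with Inverse.to σ e
... | ()
CorridorSystem-insertAt {𝓕 = 𝓕} e x (suc m , lo , hi , σ , σ-feasible) =
  m , lo′ , hi′ , remove e σ , λ F →
  Fits-insertAt-⇔ (Inverse.to σ e) x (image (remove e σ) F)
    ⇔-∘ subst (λ C → 𝓕 (insertAt F e x) ⇔ Corridor (suc m) lo hi C)
              (image-insertAt σ e x F) (σ-feasible (insertAt F e x))
  where open Merge (toℕ (Inverse.to σ e)) (+ bit x) lo hi

proper? : ∀ {S} → IsCorridorSystem S → Dec (Proper S)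
proper? {S} (N , lo , hi , σ , σ-feasible) with anySubset? (λ B → fits? N lo hi (north# B))
... | yes corridor-proper = yes (≅-proper {S} {CorridorSystem N lo hi} (σ , σ-feasible) corridor-proper)
... | no corridor-empty   =
  no λ (F , F-feasible) → corridor-empty (image σ F , Equivalence.to (σ-feasible F) F-feasible)

-- Properness of a corridor is decidable; this turns the hypothesis that e is not a (co)loop
-- into a feasible set of the minor.
Proper-insertAt : ∀ {n} {𝓕 : SetFamily (suc n)} e x → IsCorridorSystem (mkSS (suc n) 𝓕) →
  ¬ (∀ F → 𝓕 F → lookup F e ≡ not x) → Proper (mkSS n (λ F → 𝓕 (insertAt F e x)))
Proper-insertAt {𝓕 = 𝓕} e x corridor ¬forced with proper? (CorridorSystem-insertAt e x corridor)
... | yes minor-proper = minor-proper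
... | no minor-empty   = ⊥-elim (¬forced forced)
  where
  forced : ∀ F → 𝓕 F → lookup F e ≡ not x
  forced F F-feasible with lookup F e Data.Bool.Properties.≟ x
  ... | no F[e]≢x = ¬-not F[e]≢x
  ... | yes F[e]≡x = ⊥-elim (minor-empty (removeAt F e ,
    subst 𝓕 (sym (trans (cong (insertAt (removeAt F e) e) (sym F[e]≡x)) (insertAt-removeAt F e))) F-feasible))

minor-CorridorSystem : ∀ {T S} → T ≼ S → IsCorridorSystem S → Proper S → IsCorridorSystem T × Proper T
minor-CorridorSystem here corridor proper = corridor , proper
minor-CorridorSystem (del e _ ¬coloop T≼S∖e) corridor _ =
  minor-CorridorSystem T≼S∖e (CorridorSystem-insertAt e outside corridor)
    (Proper-insertAt e outside corridor λ e∈all →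
      ¬coloop λ F F-feasible → lookup⇒[]= e F (e∈all F F-feasible))
minor-CorridorSystem (con e _ ¬loop T≼S/e) corridor _ =
  minor-CorridorSystem T≼S/e (CorridorSystem-insertAt e inside corridor)
    (Proper-insertAt e inside corridor λ e∉all → ¬loop λ F F-feasible e∈F →
      true≢false (trans (sym ([]=⇒lookup e∈F)) (e∉all F F-feasible)))
  where
  true≢false : true ≢ false
  true≢false ()

proposition4p2 : (S : SetSystem) → IsLatticePathDM S →
    IsLatticePathDM (dual S) × (∀ T → T ≼ S → IsLatticePathDM T)
proposition4p2 S S-lattice-path =
  properCorridorSystem⇒LatticePathDM (CorridorSystem-dual corridor) (Proper-dual proper) ,
  λ T T≼S → let (T-corridor , T-proper) = minor-CorridorSystem T≼S corridor proper
            in properCorridorSystem⇒LatticePathDM T-corridor T-proper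
  where
  corridor : IsCorridorSystem S
  corridor = LatticePathDM⇒CorridorSystem S-lattice-path
  proper : Proper S
  proper = LatticePathDM⇒Proper S-lattice-path
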